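{- Let $q\in\mathbb{C}$, $s\in\mathbb{N}_0$, $\alpha_0,\dots,\alpha_s\in\mathbb{C}$, and let $X,Y$ satisfy $XY-qYX=\sum_{j=0}^s\alpha_jY^j$. Let $\mathscr{S}_{\boldsymbol{\alpha};q}(n;j,k)$ be the coefficient of $Y^jX^k$ in the normal ordered expansion of $(YX)^n$, with $\mathscr{S}_{\boldsymbol{\alpha};q}(n;j,k)=0$ if $j<0$ or $k<0$. Then for all $n\ge0$, $j\ge1$, $k\ge0$, $$\mathscr{S}_{\boldsymbol{\alpha};q}(n+1;j,k)=q^{j-1}\mathscr{S}_{\boldsymbol{\alpha};q}(n;j-1,k-1)+\sum_{r=0}^s\alpha_r[j-r]_q\,\mathscr{S}_{\boldsymbol{\alpha};q}(n;j-r,k).$$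
   Context: The monomials $Y^jX^k$ form a basis of this algebra. $[m]_q=1+q+\cdots+q^{m-1}$ for $m\ge1$ and $[m]_q=0$ for $m\le 0$ (terms with a negative index vanish anyway). -}

module Defs where

open import Level using (_⊔_)
open import Data.Nat using (ℕ; zero; suc; _<_; _≤_)
open import Data.Integer using (ℤ; +_; -[1+_])
open import Data.Product using (Σ; _×_)
open import Data.Sum using (_⊎_)
open import Algebra.Bundles using (Ring; CommutativeRing)
open import Algebra.Morphism.Structures using (module RingMorphisms)

module _ {a ℓ} (R : Ring a ℓ) where
  open Ring R

  pow : Carrier → ℕ → Carrier
  pow x zero    = 1#
  pow x (suc n) = x * pow x n

  ∑< : ℕ → (ℕ → Carrier) → Carrier
  ∑< zero    f = 0#
  ∑< (suc n) f = ∑< n f + f n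

  -- q-integer [m]_q = 1 + q + ... + q^(m-1) for m ≥ 1, and 0 for m ≤ 0.
  qint : Carrier → ℤ → Carrier
  qint q (+ m)      = ∑< m (λ i → pow q i)
  qint q -[1+ m ]   = 0#

  ext0 : (ℕ → ℕ → Carrier) → ℤ → ℤ → Carrier
  ext0 f (+ j) (+ k) = f j k
  ext0 f (+ j) -[1+ k ] = 0#
  ext0 f -[1+ j ] _ = 0#

-- Setting: A is an algebra over the commutative ring R via a central ring
-- homomorphism ι : R → A, and X, Y ∈ A.
module Setting {c ℓ a ℓ'} (R : CommutativeRing c ℓ) (A : Ring a ℓ')
               (ι : CommutativeRing.Carrier R → Ring.Carrier A) where
  private
    module R = CommutativeRing R
    module A = Ring A

  IsAlgebraStructure : Set (c ⊔ ℓ ⊔ a ⊔ ℓ')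
  IsAlgebraStructure =
    RingMorphisms.IsRingHomomorphism (R.rawRing) (A.rawRing) ι
    × (∀ r x → (ι r A.* x) A.≈ (x A.* ι r))

  mono : A.Carrier → A.Carrier → ℕ → ℕ → A.Carrier
  mono X Y j k = pow A Y j A.* pow A X k

  Relation : R.Carrier → (s : ℕ) → (ℕ → R.Carrier) → A.Carrier → A.Carrier → Set ℓ'
  Relation q s α X Y =
    ((X A.* Y) A.- (ι q A.* (Y A.* X)))
      A.≈ ∑< A (suc s) (λ j → ι (α j) A.* pow A Y j)

  combo : A.Carrier → A.Carrier → ℕ → (ℕ → ℕ → R.Carrier) → A.Carrier
  combo X Y N coef = ∑< A N (λ j → ∑< A N (λ k → ι (coef j k) A.* mono X Y j k))

  MonomialsIndependent : A.Carrier → A.Carrier → Set (c ⊔ ℓ ⊔ ℓ')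
  MonomialsIndependent X Y =
    ∀ (N : ℕ) (coef : ℕ → ℕ → R.Carrier) → combo X Y N coef A.≈ A.0# →
    ∀ j k → j < N → k < N → coef j k R.≈ R.0#

  IsNormalOrderedCoefficients : A.Carrier → A.Carrier → (ℕ → ℕ → ℕ → R.Carrier)
                                → Set (ℓ ⊔ ℓ')
  IsNormalOrderedCoefficients X Y S =
    ∀ n → Σ ℕ λ N →
      (∀ j k → N ≤ j ⊎ N ≤ k → S n j k R.≈ R.0#)
      × (pow A (Y A.* X) n A.≈ combo X Y N (S n))

-- From the relation XY = q YX + Σ α_r Y^r one gets, by induction on j,
--   (YX) Y^j = q^j Y^(j+1) X + [j]_q Y^j Σ_r α_r Y^r,
-- so left multiplication by YX sends Y^j X^k to q^j Y^(j+1) X^(k+1) plus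
-- Σ_r α_r [j]_q Y^(r+j) X^k. Applying this to the normal ordered expansion of
-- (YX)^n and reindexing gives a normal ordered expansion of (YX)^(n+1) whose
-- coefficients are the right-hand side of the recurrence; since the monomials
-- are independent, these coefficients are the S(n+1; j, k).
module Submission where

open import Defs
open import Data.Nat using (ℕ; suc; _≤_; _∸_)
open import Data.Integer using (+_; _-_)
open import Algebra.Bundles using (Ring; CommutativeRing)

open import Data.Nat using (zero; _<_; _≤′_; ≤′-refl; ≤′-step; z≤n; s≤s)
  renaming (_+_ to _+ℕ_)
import Data.Nat.Properties as ℕ
open import Data.Integer using (-[1+_])
import Data.Integer.Properties as ℤ
open import Data.Empty using (⊥-elim)
open import Data.Product using (∃; _,_; proj₁; proj₂)
open import Data.Sum using (_⊎_; inj₁; inj₂)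
open import Algebra.Morphism.Structures using (module RingMorphisms)
import Relation.Binary.PropositionalEquality as ≡
open ≡ using (_≡_)

+[m+n]-+m≡+n : ∀ m n → + (m +ℕ n) - + m ≡ + n
+[m+n]-+m≡+n m n = ≡.trans (ℤ.[+m]-[+n]≡m⊖n (m +ℕ n) m)
  (≡.trans (ℤ.⊖-≥ (ℕ.m≤m+n m n)) (≡.cong +_ (ℕ.m+n∸m≡n m n)))

+m-+n<0 : ∀ {m n} → m < n → ∃ λ t → + m - + n ≡ -[1+ t ]
+m-+n<0 {m} {n} m<n with n ∸ m in n∸m≡
... | zero  = ⊥-elim (ℕ.m>n⇒m∸n≢0 m<n n∸m≡)
... | suc t = t , ≡.trans (ℤ.[+m]-[+n]≡m⊖n m n)
                    (≡.trans (ℤ.⊖-< m<n) (≡.cong (λ u → Data.Integer.- (+ u)) n∸m≡))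

module RingSums {a ℓ} (R : Ring a ℓ) where
  open Ring R
  open import Algebra.Properties.Ring R using (-0#≈0#; -‿+-comm)
  open import Relation.Binary.Reasoning.Setoid setoid

  pow-sucʳ : ∀ x n → pow R x n * x ≈ pow R x (suc n)
  pow-sucʳ x zero    = trans (*-identityˡ x) (sym (*-identityʳ x))
  pow-sucʳ x (suc n) = trans (*-assoc _ _ _) (*-congˡ (pow-sucʳ x n))

  pow-+ : ∀ x m n → pow R x m * pow R x n ≈ pow R x (m +ℕ n)
  pow-+ x zero    n = *-identityˡ _
  pow-+ x (suc m) n = trans (*-assoc _ _ _) (*-congˡ (pow-+ x m n))

  ∑<-cong-< : ∀ n {f g : ℕ → Carrier} → (∀ i → i < n → f i ≈ g i) → ∑< R n f ≈ ∑< R n g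
  ∑<-cong-< zero    f≈g = refl
  ∑<-cong-< (suc n) f≈g =
    +-cong (∑<-cong-< n (λ i i<n → f≈g i (ℕ.m≤n⇒m≤1+n i<n))) (f≈g n ℕ.≤-refl)

  ∑<-cong : ∀ n {f g : ℕ → Carrier} → (∀ i → f i ≈ g i) → ∑< R n f ≈ ∑< R n g
  ∑<-cong n f≈g = ∑<-cong-< n (λ i _ → f≈g i)

  ∑<-zero : ∀ n {f : ℕ → Carrier} → (∀ i → i < n → f i ≈ 0#) → ∑< R n f ≈ 0#
  ∑<-zero n f≈0 = trans (∑<-cong-< n f≈0) (∑<-zero′ n)
    where
    ∑<-zero′ : ∀ n → ∑< R n (λ _ → 0#) ≈ 0#
    ∑<-zero′ zero    = refl
    ∑<-zero′ (suc n) = trans (+-identityʳ _) (∑<-zero′ n)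

  ∑<-+ : ∀ n f g → ∑< R n (λ i → f i + g i) ≈ ∑< R n f + ∑< R n g
  ∑<-+ zero    f g = sym (+-identityˡ 0#)
  ∑<-+ (suc n) f g = begin
    ∑< R n (λ i → f i + g i) + (f n + g n)    ≈⟨ +-congʳ (∑<-+ n f g) ⟩
    (∑< R n f + ∑< R n g) + (f n + g n)       ≈⟨ +-assoc _ _ _ ⟩
    ∑< R n f + (∑< R n g + (f n + g n))       ≈⟨ +-congˡ (trans (+-comm _ _) (+-assoc _ _ _)) ⟩
    ∑< R n f + (f n + (g n + ∑< R n g))       ≈⟨ sym (+-assoc _ _ _) ⟩
    (∑< R n f + f n) + (g n + ∑< R n g)       ≈⟨ +-congˡ (+-comm _ _) ⟩
    ∑< R (suc n) f + ∑< R (suc n) g           ∎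

  ∑<-neg : ∀ n f → ∑< R n (λ i → - f i) ≈ - ∑< R n f
  ∑<-neg zero    f = sym -0#≈0#
  ∑<-neg (suc n) f = trans (+-congʳ (∑<-neg n f)) (-‿+-comm _ _)

  ∑<-− : ∀ n f g → ∑< R n (λ i → f i + - g i) ≈ ∑< R n f + - ∑< R n g
  ∑<-− n f g = trans (∑<-+ n f (λ i → - g i)) (+-congˡ (∑<-neg n g))

  ∑<-*ˡ : ∀ n x f → x * ∑< R n f ≈ ∑< R n (λ i → x * f i)
  ∑<-*ˡ zero    x f = zeroʳ x
  ∑<-*ˡ (suc n) x f = trans (distribˡ x _ _) (+-congʳ (∑<-*ˡ n x f))

  ∑<-*ʳ : ∀ n x f → ∑< R n f * x ≈ ∑< R n (λ i → f i * x)
  ∑<-*ʳ zero    x f = zeroˡ x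
  ∑<-*ʳ (suc n) x f = trans (distribʳ x _ _) (+-congʳ (∑<-*ʳ n x f))

  ∑<-swap : ∀ n m (f : ℕ → ℕ → Carrier) →
            ∑< R n (λ i → ∑< R m (f i)) ≈ ∑< R m (λ j → ∑< R n (λ i → f i j))
  ∑<-swap zero    m f = sym (∑<-zero m (λ _ _ → refl))
  ∑<-swap (suc n) m f =
    trans (+-congʳ (∑<-swap n m f)) (sym (∑<-+ m (λ j → ∑< R n (λ i → f i j)) (f n)))

  ∑<-skip : ∀ a m f → (∀ i → i < a → f i ≈ 0#) → ∑< R (a +ℕ m) f ≈ ∑< R m (λ i → f (a +ℕ i))
  ∑<-skip zero    m f f≈0 = refl
  ∑<-skip (suc a) m f f≈0 = begin
    ∑< R (suc a +ℕ m) f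
      ≈⟨ ∑<-suc (a +ℕ m) f ⟩
    f 0 + ∑< R (a +ℕ m) (λ i → f (suc i))
      ≈⟨ +-cong (f≈0 0 (s≤s z≤n)) (∑<-skip a m _ (λ i i<a → f≈0 (suc i) (s≤s i<a))) ⟩
    0# + ∑< R m (λ i → f (suc a +ℕ i))
      ≈⟨ +-identityˡ _ ⟩
    ∑< R m (λ i → f (suc a +ℕ i)) ∎
    where
    ∑<-suc : ∀ n f → ∑< R (suc n) f ≈ f 0 + ∑< R n (λ i → f (suc i))
    ∑<-suc zero    f = trans (+-identityˡ _) (sym (+-identityʳ _))
    ∑<-suc (suc n) f = trans (+-congʳ (∑<-suc n f)) (+-assoc _ _ _)

  ∑<-truncate : ∀ {n m} f → n ≤ m → (∀ i → n ≤ i → f i ≈ 0#) → ∑< R m f ≈ ∑< R n f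
  ∑<-truncate {n} f n≤m f≈0 = go (ℕ.≤⇒≤′ n≤m)
    where
    go : ∀ {m} → n ≤′ m → ∑< R m f ≈ ∑< R n f
    go ≤′-refl            = refl
    go (≤′-step {m} n≤′m) = trans (+-cong (go n≤′m) (f≈0 m (ℕ.≤′⇒≤ n≤′m))) (+-identityʳ _)

  ∑∑< : ℕ → ℕ → (ℕ → ℕ → Carrier) → Carrier
  ∑∑< m n g = ∑< R m (λ i → ∑< R n (g i))

  ∑∑<-cong : ∀ m n {f g : ℕ → ℕ → Carrier} → (∀ i j → f i j ≈ g i j) → ∑∑< m n f ≈ ∑∑< m n g
  ∑∑<-cong m n f≈g = ∑<-cong m (λ i → ∑<-cong n (f≈g i))

  ∑∑<-+-∑< : ∀ r m n f (g : ℕ → ℕ → ℕ → Carrier) →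
             ∑∑< m n (λ i j → f i j + ∑< R r (λ t → g t i j))
             ≈ ∑∑< m n f + ∑< R r (λ t → ∑∑< m n (g t))
  ∑∑<-+-∑< r m n f g = begin
    ∑< R m (λ i → ∑< R n (λ j → f i j + ∑< R r (λ t → g t i j)))
      ≈⟨ ∑<-cong m (λ i → ∑<-+ n (f i) (λ j → ∑< R r (λ t → g t i j))) ⟩
    ∑< R m (λ i → ∑< R n (f i) + ∑< R n (λ j → ∑< R r (λ t → g t i j)))
      ≈⟨ ∑<-+ m _ _ ⟩
    ∑∑< m n f + ∑< R m (λ i → ∑< R n (λ j → ∑< R r (λ t → g t i j)))
      ≈⟨ +-congˡ (∑<-cong m (λ i → ∑<-swap n r (λ j t → g t i j))) ⟩
    ∑∑< m n f + ∑< R m (λ i → ∑< R r (λ t → ∑< R n (g t i)))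
      ≈⟨ +-congˡ (∑<-swap m r (λ i t → ∑< R n (g t i))) ⟩
    ∑∑< m n f + ∑< R r (λ t → ∑∑< m n (g t)) ∎

  ∑∑<-skip : ∀ a b m n g → (∀ i j → i < a ⊎ j < b → g i j ≈ 0#) →
             ∑∑< (a +ℕ m) (b +ℕ n) g ≈ ∑∑< m n (λ i j → g (a +ℕ i) (b +ℕ j))
  ∑∑<-skip a b m n g g≈0 = trans
    (∑<-skip a m _ (λ i i<a → ∑<-zero (b +ℕ n) (λ j _ → g≈0 i j (inj₁ i<a))))
    (∑<-cong m (λ i → ∑<-skip b n _ (λ j j<b → g≈0 (a +ℕ i) j (inj₂ j<b))))

  ∑∑<-truncate : ∀ {N m n} g → N ≤ m → N ≤ n → (∀ i j → N ≤ i ⊎ N ≤ j → g i j ≈ 0#) →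
                 ∑∑< m n g ≈ ∑∑< N N g
  ∑∑<-truncate {N} {m} g N≤m N≤n g≈0 = trans
    (∑<-cong m (λ i → ∑<-truncate (g i) N≤n (λ j N≤j → g≈0 i j (inj₂ N≤j))))
    (∑<-truncate _ N≤m (λ i N≤i → ∑<-zero N (λ j _ → g≈0 i j (inj₁ N≤i))))

module _ {a₁ ℓ₁ a₂ ℓ₂} (G : Ring a₁ ℓ₁) (H : Ring a₂ ℓ₂) {f : Ring.Carrier G → Ring.Carrier H}
         (f-isHom : RingMorphisms.IsRingHomomorphism (Ring.rawRing G) (Ring.rawRing H) f) where
  open Ring H
  open RingMorphisms.IsRingHomomorphism f-isHom using (+-homo; 0#-homo)

  ∑<-homo : ∀ n g → f (∑< G n g) ≈ ∑< H n (λ i → f (g i))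
  ∑<-homo zero    g = 0#-homo
  ∑<-homo (suc n) g = trans (+-homo _ _) (+-congʳ (∑<-homo n g))

module NormalOrdering {c ℓ a ℓ'} (R : CommutativeRing c ℓ) (A : Ring a ℓ')
  (ι : CommutativeRing.Carrier R → Ring.Carrier A)
  (isAlgebra : Setting.IsAlgebraStructure R A ι) where

  private module R = CommutativeRing R
  open Ring A hiding (_-_)
  open RingMorphisms.IsRingHomomorphism (proj₁ isAlgebra)
  open RingSums A
  open Setting R A ι
  open import Relation.Binary.Reasoning.Setoid setoid

  ι-*-comm : ∀ u x y → ι u * (x * y) ≈ x * (ι u * y)
  ι-*-comm u x y = begin
    ι u * (x * y)   ≈⟨ sym (*-assoc _ _ _) ⟩
    (ι u * x) * y   ≈⟨ *-congʳ (proj₂ isAlgebra u x) ⟩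
    (x * ι u) * y   ≈⟨ *-assoc _ _ _ ⟩
    x * (ι u * y)   ∎

  ι-*-ι : ∀ u v x → ι u * (ι v * x) ≈ ι (v R.* u) * x
  ι-*-ι u v x = trans (sym (*-assoc _ _ _))
    (*-congʳ (trans (sym (*-homo u v)) (⟦⟧-cong (R.*-comm u v))))

  ι-+-* : ∀ u v x → ι u * x + ι v * x ≈ ι (u R.+ v) * x
  ι-+-* u v x = trans (sym (distribʳ x _ _)) (*-congʳ (sym (+-homo u v)))

  ι-0-* : ∀ {u} x → u R.≈ R.0# → ι u * x ≈ 0#
  ι-0-* x u≈0 = trans (*-congʳ (trans (⟦⟧-cong u≈0) 0#-homo)) (zeroˡ x)

  SupportedIn : ℕ → (ℕ → ℕ → R.Carrier) → Set ℓ
  SupportedIn N c = ∀ j k → N ≤ j ⊎ N ≤ k → c j k R.≈ R.0#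

  SupportedIn-*ˡ : ∀ {N c} (f : ℕ → R.Carrier) → SupportedIn N c →
                   SupportedIn N (λ j k → f j R.* c j k)
  SupportedIn-*ˡ f supp j k out = R.trans (R.*-congˡ (supp j k out)) (R.zeroʳ _)

  ι-∑∑<-truncate : ∀ {N m n} c (e : ℕ → ℕ → Carrier) → SupportedIn N c → N ≤ m → N ≤ n →
                   ∑∑< m n (λ j k → ι (c j k) * e j k) ≈ ∑∑< N N (λ j k → ι (c j k) * e j k)
  ι-∑∑<-truncate c e supp N≤m N≤n =
    ∑∑<-truncate _ N≤m N≤n (λ j k out → ι-0-* (e j k) (supp j k out))

  module _ (X Y : Carrier) where

    combo-− : ∀ M c₁ c₂ →
              combo X Y M (λ j k → c₁ j k R.- c₂ j k) ≈ combo X Y M c₁ + - combo X Y M c₂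
    combo-− M c₁ c₂ = begin
      combo X Y M (λ j k → c₁ j k R.- c₂ j k)
        ≈⟨ ∑∑<-cong M M term-− ⟩
      ∑< A M (λ j → ∑< A M (λ k → ι (c₁ j k) * mono X Y j k + - (ι (c₂ j k) * mono X Y j k)))
        ≈⟨ ∑<-cong M (λ j → ∑<-− M _ _) ⟩
      ∑< A M (λ j → ∑< A M (λ k → ι (c₁ j k) * mono X Y j k)
                    + - ∑< A M (λ k → ι (c₂ j k) * mono X Y j k))
        ≈⟨ ∑<-− M _ _ ⟩
      combo X Y M c₁ + - combo X Y M c₂ ∎
      where
      open import Algebra.Properties.Ring A using (-‿distribˡ-*)
      term-− : ∀ j k → ι (c₁ j k R.- c₂ j k) * mono X Y j k
                       ≈ ι (c₁ j k) * mono X Y j k + - (ι (c₂ j k) * mono X Y j k)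
      term-− j k = trans (sym (ι-+-* _ _ _))
        (+-congˡ (trans (*-congʳ (-‿homo _)) (sym (-‿distribˡ-* _ _))))

    combo-injective : MonomialsIndependent X Y → ∀ M c₁ c₂ → combo X Y M c₁ ≈ combo X Y M c₂ →
                      ∀ {j k} → j < M → k < M → c₁ j k R.≈ c₂ j k
    combo-injective independent M c₁ c₂ c₁≈c₂ j<M k<M =
      x∙y⁻¹≈ε⇒x≈y _ _ (independent M _ difference≈0 _ _ j<M k<M)
      where
      open import Algebra.Properties.Ring R.ring using (x∙y⁻¹≈ε⇒x≈y)
      difference≈0 : combo X Y M (λ j k → c₁ j k R.- c₂ j k) ≈ 0#
      difference≈0 = trans (combo-− M c₁ c₂) (trans (+-congʳ c₁≈c₂) (-‿inverseʳ _))

  module Commutation (q : R.Carrier) (s : ℕ) (α : ℕ → R.Carrier) (X Y : Carrier)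
                     (relation : Relation q s α X Y) where

    Y^_ X^_ : ℕ → Carrier
    Y^_ = pow A Y
    X^_ = pow A X

    q^_ [_]q : ℕ → R.Carrier
    q^_ = pow R.ring q
    [ j ]q = qint R.ring q (+ j)

    YX αY : Carrier
    YX = Y * X
    αY = ∑< A (suc s) (λ r → ι (α r) * Y^ r)

    X*Y : X * Y ≈ ι q * YX + αY
    X*Y = begin
      X * Y                                 ≈⟨ sym (//-rightDividesˡ (ι q * YX) (X * Y)) ⟩
      (X * Y + - (ι q * YX)) + ι q * YX     ≈⟨ +-congʳ relation ⟩
      αY + ι q * YX                         ≈⟨ +-comm _ _ ⟩
      ι q * YX + αY                         ∎
      where open import Algebra.Properties.Ring A using (//-rightDividesˡ)

    αY*Y : αY * Y ≈ Y * αY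
    αY*Y = trans (∑<-*ʳ (suc s) Y _) (trans (∑<-cong (suc s) commute) (sym (∑<-*ˡ (suc s) Y _)))
      where
      commute : ∀ r → ι (α r) * Y^ r * Y ≈ Y * (ι (α r) * Y^ r)
      commute r = trans (*-assoc _ _ _) (trans (*-congˡ (pow-sucʳ Y r)) (ι-*-comm _ _ _))

    Y^*X*Y : ∀ j → Y^ j * (X * Y) ≈ ι q * (Y^ suc j * X) + Y^ j * αY
    Y^*X*Y j = begin
      Y^ j * (X * Y)                        ≈⟨ *-congˡ X*Y ⟩
      Y^ j * (ι q * YX + αY)                ≈⟨ distribˡ _ _ _ ⟩
      Y^ j * (ι q * YX) + Y^ j * αY         ≈⟨ +-congʳ (sym (ι-*-comm _ _ _)) ⟩
      ι q * (Y^ j * (Y * X)) + Y^ j * αY    ≈⟨ +-congʳ (*-congˡ (sym (*-assoc _ _ _))) ⟩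
      ι q * (Y^ j * Y * X) + Y^ j * αY      ≈⟨ +-congʳ (*-congˡ (*-congʳ (pow-sucʳ Y j))) ⟩
      ι q * (Y^ suc j * X) + Y^ j * αY      ∎

    YX*Y^ : ∀ j → YX * Y^ j ≈ ι (q^ j) * (Y^ suc j * X) + ι [ j ]q * (Y^ j * αY)
    YX*Y^ zero = begin
      YX * 1#                                     ≈⟨ *-identityʳ YX ⟩
      Y * X                                       ≈⟨ *-congʳ (sym (*-identityʳ Y)) ⟩
      Y^ 1 * X                                    ≈⟨ sym (*-identityˡ _) ⟩
      1# * (Y^ 1 * X)                             ≈⟨ *-congʳ (sym 1#-homo) ⟩
      ι R.1# * (Y^ 1 * X)                         ≈⟨ sym (+-identityʳ _) ⟩
      ι R.1# * (Y^ 1 * X) + 0#                    ≈⟨ +-congˡ (sym (ι-0-* _ R.refl)) ⟩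
      ι R.1# * (Y^ 1 * X) + ι R.0# * (Y^ 0 * αY)  ∎
    YX*Y^ (suc j) = begin
      YX * (Y * Y^ j)
        ≈⟨ *-congˡ (sym (pow-sucʳ Y j)) ⟩
      YX * (Y^ j * Y)
        ≈⟨ sym (*-assoc _ _ _) ⟩
      YX * Y^ j * Y
        ≈⟨ *-congʳ (YX*Y^ j) ⟩
      (ι (q^ j) * (Y^ suc j * X) + ι [ j ]q * w) * Y
        ≈⟨ distribʳ _ _ _ ⟩
      ι (q^ j) * (Y^ suc j * X) * Y + ι [ j ]q * w * Y
        ≈⟨ +-cong (trans (*-assoc _ _ _) (*-congˡ (*-assoc _ _ _)))
                  (trans (*-assoc _ _ _) (*-congˡ w*Y)) ⟩
      ι (q^ j) * (Y^ suc j * (X * Y)) + ι [ j ]q * w′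
        ≈⟨ +-congʳ (*-congˡ (Y^*X*Y (suc j))) ⟩
      ι (q^ j) * (ι q * m + w′) + ι [ j ]q * w′
        ≈⟨ trans (+-congʳ (distribˡ _ _ _)) (+-assoc _ _ _) ⟩
      ι (q^ j) * (ι q * m) + (ι (q^ j) * w′ + ι [ j ]q * w′)
        ≈⟨ +-cong (ι-*-ι _ _ _) (trans (ι-+-* _ _ _) (*-congʳ (⟦⟧-cong (R.+-comm _ _)))) ⟩
      ι (q^ suc j) * m + ι [ suc j ]q * w′ ∎
      where
      m = Y^ suc (suc j) * X
      w = Y^ j * αY
      w′ = Y^ suc j * αY
      w*Y : w * Y ≈ w′
      w*Y = trans (*-assoc _ _ _) (trans (*-congˡ αY*Y)
              (trans (sym (*-assoc _ _ _)) (*-congʳ (pow-sucʳ Y j))))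

    Y^*αY*X^ : ∀ j k → Y^ j * αY * X^ k ≈ ∑< A (suc s) (λ r → ι (α r) * mono X Y (r +ℕ j) k)
    Y^*αY*X^ j k = begin
      Y^ j * αY * X^ k
        ≈⟨ *-congʳ (∑<-*ˡ (suc s) _ _) ⟩
      ∑< A (suc s) (λ r → Y^ j * (ι (α r) * Y^ r)) * X^ k
        ≈⟨ ∑<-*ʳ (suc s) _ _ ⟩
      ∑< A (suc s) (λ r → Y^ j * (ι (α r) * Y^ r) * X^ k)
        ≈⟨ ∑<-cong (suc s) (λ r → trans (*-congʳ (trans (sym (ι-*-comm _ _ _)) (*-congˡ (Y^*Y^ r))))
                                       (*-assoc _ _ _)) ⟩
      ∑< A (suc s) (λ r → ι (α r) * mono X Y (r +ℕ j) k) ∎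
      where
      Y^*Y^ : ∀ r → Y^ j * Y^ r ≈ Y^ (r +ℕ j)
      Y^*Y^ r = trans (pow-+ Y j r) (reflexive (≡.cong Y^_ (ℕ.+-comm j r)))

    YX*monomial : ∀ u j k →
      YX * (ι u * mono X Y j k)
      ≈ ι (q^ j R.* u) * mono X Y (suc j) (suc k)
        + ∑< A (suc s) (λ r → ι (α r R.* ([ j ]q R.* u)) * mono X Y (r +ℕ j) k)
    YX*monomial u j k = begin
      YX * (ι u * (Y^ j * X^ k))
        ≈⟨ sym (ι-*-comm _ _ _) ⟩
      ι u * (YX * (Y^ j * X^ k))
        ≈⟨ *-congˡ (sym (*-assoc _ _ _)) ⟩
      ι u * (YX * Y^ j * X^ k)
        ≈⟨ *-congˡ (*-congʳ (YX*Y^ j)) ⟩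
      ι u * ((ι (q^ j) * (Y^ suc j * X) + ι [ j ]q * (Y^ j * αY)) * X^ k)
        ≈⟨ *-congˡ (distribʳ _ _ _) ⟩
      ι u * (ι (q^ j) * (Y^ suc j * X) * X^ k + ι [ j ]q * (Y^ j * αY) * X^ k)
        ≈⟨ *-congˡ (+-cong (trans (*-assoc _ _ _) (*-congˡ (*-assoc _ _ _)))
                           (trans (*-assoc _ _ _) (*-congˡ (Y^*αY*X^ j k)))) ⟩
      ι u * (ι (q^ j) * mono X Y (suc j) (suc k) + ι [ j ]q * σ)
        ≈⟨ distribˡ _ _ _ ⟩
      ι u * (ι (q^ j) * mono X Y (suc j) (suc k)) + ι u * (ι [ j ]q * σ)
        ≈⟨ +-cong (ι-*-ι _ _ _) (trans (ι-*-ι _ _ _)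
                  (trans (∑<-*ˡ (suc s) _ _) (∑<-cong (suc s) (λ r → ι-*-ι _ _ _)))) ⟩
      ι (q^ j R.* u) * mono X Y (suc j) (suc k)
        + ∑< A (suc s) (λ r → ι (α r R.* ([ j ]q R.* u)) * mono X Y (r +ℕ j) k) ∎
      where σ = ∑< A (suc s) (λ r → ι (α r) * mono X Y (r +ℕ j) k)

    weighted : (ℕ → ℕ → R.Carrier) → ℕ → ℕ → Carrier
    weighted c j k = ι (c j k) * mono X Y j k

    qTerms : (ℕ → ℕ → R.Carrier) → ℕ → ℕ → Carrier
    qTerms c j k = ι (q^ j R.* c j k) * mono X Y (suc j) (suc k)

    αTerms : (ℕ → ℕ → R.Carrier) → ℕ → ℕ → ℕ → Carrier
    αTerms c r j k = ι (α r R.* ([ j ]q R.* c j k)) * mono X Y (r +ℕ j) k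

    YX*combo : ∀ N c → YX * combo X Y N c
                       ≈ ∑∑< N N (qTerms c) + ∑< A (suc s) (λ r → ∑∑< N N (αTerms c r))
    YX*combo N c = begin
      YX * combo X Y N c
        ≈⟨ ∑<-*ˡ N _ _ ⟩
      ∑< A N (λ j → YX * ∑< A N (weighted c j))
        ≈⟨ ∑<-cong N (λ j → trans (∑<-*ˡ N _ _) (∑<-cong N (λ k → YX*monomial (c j k) j k))) ⟩
      ∑∑< N N (λ j k → qTerms c j k + ∑< A (suc s) (λ r → αTerms c r j k))
        ≈⟨ ∑∑<-+-∑< (suc s) N N _ _ ⟩
      ∑∑< N N (qTerms c) + ∑< A (suc s) (λ r → ∑∑< N N (αTerms c r)) ∎

    qCoefficient : (ℕ → ℕ → R.Carrier) → ℕ → ℕ → R.Carrier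
    qCoefficient c J K = q^ (J ∸ 1) R.* ext0 R.ring c (+ J - + 1) (+ K - + 1)

    αCoefficient : (ℕ → ℕ → R.Carrier) → ℕ → ℕ → ℕ → R.Carrier
    αCoefficient c r J K = α r R.* (qint R.ring q (+ J - + r) R.* ext0 R.ring c (+ J - + r) (+ K))

    YX*-coefficients : (ℕ → ℕ → R.Carrier) → ℕ → ℕ → R.Carrier
    YX*-coefficients c J K = qCoefficient c J K R.+ ∑< R.ring (suc s) (λ r → αCoefficient c r J K)

    module _ {N : ℕ} (c : ℕ → ℕ → R.Carrier) (supp : SupportedIn N c) where

      qCoefficients-shift : ∀ M → N ≤ M →
        ∑∑< (suc M) (suc M) (weighted (qCoefficient c)) ≈ ∑∑< N N (qTerms c)
      qCoefficients-shift M N≤M = trans (∑∑<-skip 1 1 M M _ vanish)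
        (ι-∑∑<-truncate _ _ (SupportedIn-*ˡ q^_ supp) N≤M N≤M)
        where
        vanish : ∀ J K → J < 1 ⊎ K < 1 → weighted (qCoefficient c) J K ≈ 0#
        vanish zero    K       _                = ι-0-* _ (R.zeroʳ _)
        vanish (suc J) zero    _                = ι-0-* _ (R.zeroʳ _)
        vanish (suc J) (suc K) (inj₁ (s≤s ()))
        vanish (suc J) (suc K) (inj₂ (s≤s ()))

      αCoefficients-shift : ∀ r M → N +ℕ r ≤ M →
        ∑∑< M M (weighted (αCoefficient c r)) ≈ ∑∑< N N (αTerms c r)
      αCoefficients-shift r M N+r≤M = begin
        ∑∑< M M (weighted (αCoefficient c r))
          ≈⟨ reflexive (≡.cong (λ m → ∑∑< m M _) (≡.sym (ℕ.m+[n∸m]≡n r≤M))) ⟩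
        ∑∑< (r +ℕ (M ∸ r)) M (weighted (αCoefficient c r))
          ≈⟨ ∑∑<-skip r 0 (M ∸ r) M _ vanish ⟩
        ∑∑< (M ∸ r) M (λ j K → weighted (αCoefficient c r) (r +ℕ j) K)
          ≈⟨ ∑∑<-cong (M ∸ r) M (λ j K → *-congʳ (⟦⟧-cong (R.reflexive (shift j K)))) ⟩
        ∑∑< (M ∸ r) M (αTerms c r)
          ≈⟨ ι-∑∑<-truncate _ _ (SupportedIn-*ˡ (λ _ → α r) (SupportedIn-*ˡ [_]q supp))
               (ℕ.m+n≤o⇒m≤o∸n N N+r≤M) (ℕ.≤-trans (ℕ.m≤m+n N r) N+r≤M) ⟩
        ∑∑< N N (αTerms c r) ∎
        where
        r≤M : r ≤ M
        r≤M = ℕ.≤-trans (ℕ.m≤n+m r N) N+r≤M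
        shift : ∀ j K → αCoefficient c r (r +ℕ j) K ≡ α r R.* ([ j ]q R.* c j K)
        shift j K rewrite +[m+n]-+m≡+n r j = ≡.refl
        vanish : ∀ J K → J < r ⊎ K < 0 → weighted (αCoefficient c r) J K ≈ 0#
        vanish J K (inj₁ J<r) with +m-+n<0 J<r
        ... | t , J-r≡ rewrite J-r≡ = ι-0-* _ (R.trans (R.*-congˡ (R.zeroˡ _)) (R.zeroʳ _))

      combo-YX*-coefficients : ∀ M → N +ℕ s ≤ M →
        combo X Y (suc M) (YX*-coefficients c)
        ≈ ∑∑< N N (qTerms c) + ∑< A (suc s) (λ r → ∑∑< N N (αTerms c r))
      combo-YX*-coefficients M N+s≤M = begin
        combo X Y (suc M) (YX*-coefficients c)
          ≈⟨ ∑∑<-cong (suc M) (suc M) split ⟩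
        ∑∑< (suc M) (suc M) (λ J K → weighted (qCoefficient c) J K
                                     + ∑< A (suc s) (λ r → weighted (αCoefficient c r) J K))
          ≈⟨ ∑∑<-+-∑< (suc s) (suc M) (suc M) _ _ ⟩
        ∑∑< (suc M) (suc M) (weighted (qCoefficient c))
          + ∑< A (suc s) (λ r → ∑∑< (suc M) (suc M) (weighted (αCoefficient c r)))
          ≈⟨ +-cong (qCoefficients-shift M (ℕ.≤-trans (ℕ.m≤m+n N s) N+s≤M))
                    (∑<-cong-< (suc s) (λ r r≤s → αCoefficients-shift r (suc M)
                      (ℕ.m≤n⇒m≤1+n (ℕ.≤-trans (ℕ.+-monoʳ-≤ N (ℕ.≤-pred r≤s)) N+s≤M)))) ⟩
        ∑∑< N N (qTerms c) + ∑< A (suc s) (λ r → ∑∑< N N (αTerms c r)) ∎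
        where
        split : ∀ J K → weighted (YX*-coefficients c) J K
                        ≈ weighted (qCoefficient c) J K
                          + ∑< A (suc s) (λ r → weighted (αCoefficient c r) J K)
        split J K = trans (sym (ι-+-* _ _ _)) (+-congˡ (trans
          (*-congʳ (∑<-homo R.ring A (proj₁ isAlgebra) (suc s) _)) (∑<-*ʳ (suc s) _ _)))

      YX*combo≈combo : ∀ M → N +ℕ s ≤ M →
                       YX * combo X Y N c ≈ combo X Y (suc M) (YX*-coefficients c)
      YX*combo≈combo M N+s≤M = trans (YX*combo N c) (sym (combo-YX*-coefficients M N+s≤M))

proposition4p15 :
    ∀ {c ℓ a ℓ'} (R : CommutativeRing c ℓ) (A : Ring a ℓ')
      (ι : CommutativeRing.Carrier R → Ring.Carrier A) →
      Setting.IsAlgebraStructure R A ι →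
      (q : CommutativeRing.Carrier R) (s : ℕ) (α : ℕ → CommutativeRing.Carrier R)
      (X Y : Ring.Carrier A) →
      Setting.Relation R A ι q s α X Y →
      Setting.MonomialsIndependent R A ι X Y →
      (S : ℕ → ℕ → ℕ → CommutativeRing.Carrier R) →
      Setting.IsNormalOrderedCoefficients R A ι X Y S →
      ∀ (n j k : ℕ) → 1 ≤ j →
      CommutativeRing._≈_ R (S (suc n) j k)
        (CommutativeRing._+_ R
          (CommutativeRing._*_ R (pow (CommutativeRing.ring R) q (j ∸ 1))
            (ext0 (CommutativeRing.ring R) (S n) (+ j - + 1) (+ k - + 1)))
          (∑< (CommutativeRing.ring R) (suc s) (λ r →
            CommutativeRing._*_ R (α r)
              (CommutativeRing._*_ R (qint (CommutativeRing.ring R) q (+ j - + r))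
                (ext0 (CommutativeRing.ring R) (S n) (+ j - + r) (+ k))))))
proposition4p15 R A ι isAlgebra q s α X Y relation independent S normalOrdered n j k _
  with normalOrdered n | normalOrdered (suc n)
... | N , supportₙ , expansionₙ | N′ , supportₙ₊₁ , expansionₙ₊₁ =
  combo-injective X Y independent (suc M) (S (suc n)) (YX*-coefficients (S n)) expansion
    (s≤s (ℕ.≤-trans (ℕ.m≤m+n j k) j+k≤M)) (s≤s (ℕ.≤-trans (ℕ.m≤n+m k j) j+k≤M))
  where
  open NormalOrdering R A ι isAlgebra
  open Commutation q s α X Y relation
  open Ring A using (_≈_; _*_; *-congˡ; setoid)
  open import Relation.Binary.Reasoning.Setoid setoid
  open Setting R A ι using (combo; mono)

  M = (N +ℕ s) +ℕ (N′ +ℕ (j +ℕ k))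

  j+k≤M : j +ℕ k ≤ M
  j+k≤M = ℕ.≤-trans (ℕ.m≤n+m (j +ℕ k) N′) (ℕ.m≤n+m _ (N +ℕ s))

  N′≤M : N′ ≤ suc M
  N′≤M = ℕ.m≤n⇒m≤1+n (ℕ.≤-trans (ℕ.m≤m+n N′ (j +ℕ k)) (ℕ.m≤n+m _ (N +ℕ s)))

  expansion : combo X Y (suc M) (S (suc n)) ≈ combo X Y (suc M) (YX*-coefficients (S n))
  expansion = begin
    combo X Y (suc M) (S (suc n))
      ≈⟨ ι-∑∑<-truncate (S (suc n)) (mono X Y) supportₙ₊₁ N′≤M N′≤M ⟩
    combo X Y N′ (S (suc n))
      ≈⟨ expansionₙ₊₁ ⟨
    YX * pow A YX n
      ≈⟨ *-congˡ expansionₙ ⟩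
    YX * combo X Y N (S n)
      ≈⟨ YX*combo≈combo (S n) supportₙ M (ℕ.m≤m+n (N +ℕ s) _) ⟩
    combo X Y (suc M) (YX*-coefficients (S n)) ∎
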